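{- Let $G$ be a finite $p$-group ($p$ a prime). Then the deleted enhanced power graph $\mathcal{G}^*_e(G)$ is connected if and only if $G$ has a unique minimal subgroup.
   Context: For a group $G$, the enhanced power graph $\mathcal{G}_e(G)$ is the simple undirected graph with vertex set $G$ in which two distinct vertices $x,y$ are adjacent if there exists $z\in G$ with $x=z^m$ and $y=z^n$ for some $m,n\in\mathbb{N}$. The deleted enhanced power graph $\mathcal{G}^*_e(G)$ is the induced subgraph of $\mathcal{G}_e(G)$ on $G\setminus\{e\}$, where $e$ is the identity. A minimal subgroup means a minimal nontrivial subgroup. -}

module Defs where

open import Data.Nat using (ℕ; zero; suc; _^_)
open import Data.Nat.Primality using (Prime)
open import Data.Fin using (Fin)
open import Data.Fin.Subset using (Subset; _∈_; _⊆_)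
open import Data.Product using (Σ; ∃; _×_; _,_)
open import Relation.Binary.PropositionalEquality using (_≡_; _≢_)
open import Algebra.Structures using (IsGroup)

-- A finite group, presented (up to isomorphism) on the carrier Fin n.
record FiniteGroup : Set where
  field
    n       : ℕ
    _∙_     : Fin n → Fin n → Fin n
    ε       : Fin n
    _⁻¹     : Fin n → Fin n
    isGroup : IsGroup _≡_ _∙_ ε _⁻¹

module _ (G : FiniteGroup) where
  open FiniteGroup G

  pow : Fin n → ℕ → Fin n
  pow z zero    = ε
  pow z (suc m) = z ∙ pow z m

  EAdj : Fin n → Fin n → Set
  EAdj x y = x ≢ y × ∃ λ z → ∃ λ a → ∃ λ b → (x ≡ pow z a) × (y ≡ pow z b)

  -- paths in the deleted enhanced power graph (all vertices ≠ ε)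
  data DPath : Fin n → Fin n → Set where
    here : ∀ {x} → DPath x x
    step : ∀ {x y w} → x ≢ ε → y ≢ ε → EAdj x y → DPath y w → DPath x w

  DeletedEnhancedConnected : Set
  DeletedEnhancedConnected =
    (∃ λ x → x ≢ ε) × (∀ x y → x ≢ ε → y ≢ ε → DPath x y)

  IsSubgroup : Subset n → Set
  IsSubgroup S = (ε ∈ S) × (∀ {x y} → x ∈ S → y ∈ S → (x ∙ y) ∈ S)
                 × (∀ {x} → x ∈ S → (x ⁻¹) ∈ S)

  Nontrivial : Subset n → Set
  Nontrivial S = ∃ λ x → (x ∈ S) × (x ≢ ε)

  IsMinimalSubgroup : Subset n → Set
  IsMinimalSubgroup S = IsSubgroup S × Nontrivial S ×
    (∀ T → IsSubgroup T → Nontrivial T → T ⊆ S → T ≡ S)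

  HasUniqueMinimalSubgroup : Set
  HasUniqueMinimalSubgroup =
    ∃ λ S → IsMinimalSubgroup S × (∀ T → IsMinimalSubgroup T → T ≡ S)

  IsPGroup : ℕ → Set
  IsPGroup p = ∃ λ k → n ≡ p ^ k

module Submission where

-- In a p-group every x ≠ ε has order p^(1+m) (Lagrange for ⟨x⟩), so Ω x = ⟨x^(ord x / p)⟩
-- is the subgroup of order p of the cyclic group ⟨x⟩.  By Bézout x^gcd(a, ord x) ∈ ⟨x^a⟩,
-- and if x^a ≠ ε then gcd(a, ord x) is a proper divisor of p^(1+m), hence divides ord x / p;
-- so Ω y = Ω x for every nontrivial power y of x.  Adjacent vertices of the deleted
-- enhanced power graph are nontrivial powers of a common element, so Ω is constant on
-- its components.  Every Ω x is a minimal subgroup and every minimal subgroup S is Ω s for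
-- any s ∈ S ∖ {ε}: connectedness thus leaves only one minimal subgroup.  Conversely, if S
-- is the only one, a fixed s ∈ S ∖ {ε} lies in S = Ω x ⊆ ⟨x⟩ for every x ≠ ε, so every
-- vertex is equal or adjacent to s.

open import Defs
open import Level using (Level; 0ℓ)
open import Data.Nat.Base
  using ( ℕ; zero; suc; _+_; _*_; _∸_; _^_; _<_; _≤_; s≤s; s≤s⁻¹; z<s
        ; NonZero; NonTrivial; >-nonZero⁻¹; nonTrivial⇒n>1)
open import Data.Nat.Properties hiding (_≟_)
open import Data.Nat.Divisibility
open import Data.Nat.DivMod
  using (_%_; _/_; m%n<n; m≡m%n+[m/n]*n; m*n/n≡m; m/n*n≡m; m/n<m; m≥n⇒m/n>0)
open import Data.Nat.GCD using (gcd; gcd-GCD; gcd[m,n]∣m; gcd[m,n]∣n; module Bézout)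
open import Data.Nat.Coprimality using (Coprime; coprime-divisor)
open import Data.Nat.Primality using (Prime; prime⇒irreducible; prime⇒nonZero; prime⇒nonTrivial)
open import Data.Nat.Induction using (<-rec)
open import Data.Fin.Base using (Fin; toℕ)
open import Data.Fin.Properties using (pigeonhole; _≟_)
open import Data.List.Base using (List; []; _∷_; length; filter; applyUpTo)
open import Data.Product using (∃; _×_; _,_; proj₁; proj₂)
open import Data.Sum using (_⊎_; inj₁; inj₂; [_,_])
open import Data.Empty using (⊥-elim)
open import Function.Base using (id; _∘_)
open import Function.Bundles using (_⇔_; mk⇔; Equivalence)
open import Relation.Nullary using (¬_; Dec; yes; no)
open import Relation.Nullary.Decidable using (map′)
open import Relation.Unary using (Decidable)
open import Relation.Unary.Properties using (∁?)
open import Relation.Binary.Definitions using (tri<; tri≈; tri>)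
open import Relation.Binary.PropositionalEquality hiding ([_])
open import Algebra.Bundles using (Group)
open import Algebra.Structures using (IsGroup)

private
  variable
    ℓ : Level

Least : (ℕ → Set ℓ) → ℕ → Set ℓ
Least P m = P m × (∀ {k} → k < m → ¬ P k)

least-witness : ∀ {P : ℕ → Set ℓ} → Decidable P → ∀ {t} → P t → ∃ (Least P)
least-witness {P = P} P? {t} = <-rec (λ t → P t → ∃ (Least P)) search t
  where
  search : ∀ t → (∀ {s} → s < t → P s → ∃ (Least P)) → P t → ∃ (Least P)
  search t smaller pt with anyUpTo? P? t
  ... | yes (s , s<t , ps) = smaller s<t ps
  ... | no ∄ = t , pt , λ k<t pk → ∄ (_ , k<t , pk)

length-filter-split : ∀ {A : Set} {P : A → Set} (P? : Decidable P) xs →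
  length xs ≡ length (filter P? xs) + length (filter (∁? P?) xs)
length-filter-split P? [] = refl
length-filter-split P? (y ∷ xs) with P? y
... | yes _ = cong suc (length-filter-split P? xs)
... | no _  = trans (cong suc (length-filter-split P? xs)) (sym (+-suc _ _))

module PrimePowerDivisors {p : ℕ} (p-prime : Prime p) where
  private instance
    p≢0 : NonZero p
    p≢0 = prime⇒nonZero p-prime

  ∤⇒coprime : ∀ {d} → ¬ p ∣ d → Coprime d p
  ∤⇒coprime p∤d (c∣d , c∣p) with prime⇒irreducible p-prime c∣p
  ... | inj₁ c≡1    = c≡1
  ... | inj₂ refl   = ⊥-elim (p∤d c∣d)

  ∣p^[1+m]⇒≡∨∣p^m : ∀ m {d} → d ∣ p ^ suc m → d ≡ p ^ suc m ⊎ d ∣ p ^ m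
  ∣p^[1+m]⇒≡∨∣p^m m {d} d∣ with p ∣? d
  ... | no p∤d = inj₂ (coprime-divisor (∤⇒coprime p∤d) d∣)
  ... | yes (divides q refl) = cofactor m (*-cancelʳ-∣ p (subst (q * p ∣_) (*-comm p (p ^ m)) d∣))
    where
    cofactor : ∀ m → q ∣ p ^ m → q * p ≡ p ^ suc m ⊎ q * p ∣ p ^ m
    cofactor zero    q∣1 = inj₁ (trans (cong (_* p) (∣1⇒≡1 q∣1)) (*-comm 1 p))
    cofactor (suc m) q∣ with ∣p^[1+m]⇒≡∨∣p^m m q∣
    ... | inj₁ q≡    = inj₁ (trans (cong (_* p) q≡) (*-comm (p ^ suc m) p))
    ... | inj₂ q∣p^m = inj₂ (subst (q * p ∣_) (*-comm (p ^ m) p) (*-monoˡ-∣ p q∣p^m))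

  ∣p^⇒≡p^ : ∀ k {d} → d ∣ p ^ k → ∃ λ i → d ≡ p ^ i
  ∣p^⇒≡p^ zero    d∣1 = 0 , ∣1⇒≡1 d∣1
  ∣p^⇒≡p^ (suc k) d∣  = [ (λ d≡ → suc k , d≡) , ∣p^⇒≡p^ k ] (∣p^[1+m]⇒≡∨∣p^m k d∣)

module Order (G : FiniteGroup) where
  open FiniteGroup G
  open IsGroup isGroup using (identityˡ; identityʳ)

  group : Group 0ℓ 0ℓ
  group = record { isGroup = isGroup }

  open import Algebra.Properties.Group group
    using (identityʳ-unique; inverseˡ-unique; inverseʳ-unique)
  open import Algebra.Properties.Monoid.Mult (Group.monoid group)
    using (×-homo-+; ×-assocˡ) renaming (_×_ to _·_)

  infixl 25 _^ᴳ_
  _^ᴳ_ : Fin n → ℕ → Fin n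
  x ^ᴳ a = pow G x a

  ^ᴳ≡· : ∀ x a → x ^ᴳ a ≡ a · x
  ^ᴳ≡· x zero    = refl
  ^ᴳ≡· x (suc a) = cong (x ∙_) (^ᴳ≡· x a)

  ^-+ : ∀ x a b → x ^ᴳ (a + b) ≡ x ^ᴳ a ∙ x ^ᴳ b
  ^-+ x a b rewrite ^ᴳ≡· x (a + b) | ^ᴳ≡· x a | ^ᴳ≡· x b = ×-homo-+ x a b

  ^-* : ∀ x a b → x ^ᴳ (a * b) ≡ (x ^ᴳ a) ^ᴳ b
  ^-* x a b rewrite ^ᴳ≡· x (a * b) | ^ᴳ≡· (x ^ᴳ a) b | ^ᴳ≡· x a | *-comm a b =
    sym (×-assocˡ x b a)

  ε^ : ∀ a → ε ^ᴳ a ≡ ε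
  ε^ zero    = refl
  ε^ (suc a) = trans (identityˡ _) (ε^ a)

  ^-1 : ∀ x → x ^ᴳ 1 ≡ x
  ^-1 = identityʳ

  ^≡^⇒^∸≡ε : ∀ x {i j} → i ≤ j → x ^ᴳ i ≡ x ^ᴳ j → x ^ᴳ (j ∸ i) ≡ ε
  ^≡^⇒^∸≡ε x {i} {j} i≤j eq = identityʳ-unique (x ^ᴳ i) _ (begin
    x ^ᴳ i ∙ x ^ᴳ (j ∸ i) ≡⟨ ^-+ x i (j ∸ i) ⟨
    x ^ᴳ (i + (j ∸ i))    ≡⟨ cong (x ^ᴳ_) (m+[n∸m]≡n i≤j) ⟩
    x ^ᴳ j                ≡⟨ eq ⟨
    x ^ᴳ i                ∎)
    where open ≡-Reasoning

  period : ∀ x → ∃ λ t → x ^ᴳ suc t ≡ ε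
  period x with pigeonhole (n<1+n n) (λ (i : Fin (suc n)) → x ^ᴳ toℕ i)
  ... | i , j , i<j , eq with toℕ j ∸ toℕ i | m<n⇒0<n∸m i<j | ^≡^⇒^∸≡ε x (<⇒≤ i<j) eq
  ...   | suc t | _ | x^t≡ε = t , x^t≡ε

  private
    least-period : ∀ x → ∃ (Least (λ t → x ^ᴳ suc t ≡ ε))
    least-period x with period x
    ... | t , x^[1+t]≡ε =
      least-witness {P = λ t → x ^ᴳ suc t ≡ ε} (λ t → x ^ᴳ suc t ≟ ε) {t} x^[1+t]≡ε

  opaque
    ord : Fin n → ℕ
    ord x = suc (proj₁ (least-period x))

    instance
      ord-nonZero : ∀ {x} → NonZero (ord x)
      ord-nonZero = _

    ^-ord : ∀ x → x ^ᴳ ord x ≡ ε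
    ^-ord x = proj₁ (proj₂ (least-period x))

    ^≢ε-below-ord : ∀ x {k} → 0 < k → k < ord x → x ^ᴳ k ≢ ε
    ^≢ε-below-ord x {suc k} _ (s≤s k<) = proj₂ (proj₂ (least-period x)) k<

  ord∣⇒^≡ε : ∀ x {a} → ord x ∣ a → x ^ᴳ a ≡ ε
  ord∣⇒^≡ε x (divides q refl) = begin
    x ^ᴳ (q * ord x)     ≡⟨ cong (x ^ᴳ_) (*-comm q (ord x)) ⟩
    x ^ᴳ (ord x * q)     ≡⟨ ^-* x (ord x) q ⟩
    (x ^ᴳ ord x) ^ᴳ q    ≡⟨ cong (_^ᴳ q) (^-ord x) ⟩
    ε ^ᴳ q               ≡⟨ ε^ q ⟩
    ε                    ∎
    where open ≡-Reasoning

  ^-%ord : ∀ x a → x ^ᴳ a ≡ x ^ᴳ (a % ord x)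
  ^-%ord x a = begin
    x ^ᴳ a                                       ≡⟨ cong (x ^ᴳ_) (m≡m%n+[m/n]*n a (ord x)) ⟩
    x ^ᴳ (a % ord x + a / ord x * ord x)         ≡⟨ ^-+ x (a % ord x) _ ⟩
    x ^ᴳ (a % ord x) ∙ x ^ᴳ (a / ord x * ord x)  ≡⟨ cong (x ^ᴳ (a % ord x) ∙_) x^[q*ord]≡ε ⟩
    x ^ᴳ (a % ord x) ∙ ε                         ≡⟨ identityʳ _ ⟩
    x ^ᴳ (a % ord x)                             ∎
    where
    open ≡-Reasoning
    x^[q*ord]≡ε : x ^ᴳ (a / ord x * ord x) ≡ ε
    x^[q*ord]≡ε = ord∣⇒^≡ε x (n∣m*n (a / ord x))

  ^≡ε⇒ord∣ : ∀ x {a} → x ^ᴳ a ≡ ε → ord x ∣ a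
  ^≡ε⇒ord∣ x {a} x^a≡ε with a % ord x in a%≡
  ... | zero  = m%n≡0⇒n∣m a (ord x) a%≡
  ... | suc r = ⊥-elim (^≢ε-below-ord x z<s (subst (_< ord x) a%≡ (m%n<n a (ord x)))
                  (trans (cong (x ^ᴳ_) (sym a%≡)) (trans (sym (^-%ord x a)) x^a≡ε)))

  ^-injective-below-ord : ∀ x {i j} → i < ord x → j < ord x → x ^ᴳ i ≡ x ^ᴳ j → i ≡ j
  ^-injective-below-ord x {i} {j} i< j< eq with <-cmp i j
  ... | tri≈ _ i≡j _ = i≡j
  ... | tri< i<j _ _ = ⊥-elim (^≢ε-below-ord x (m<n⇒0<n∸m i<j) (≤-<-trans (m∸n≤m j i) j<)
                         (^≡^⇒^∸≡ε x (<⇒≤ i<j) eq))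
  ... | tri> _ _ j<i = ⊥-elim (^≢ε-below-ord x (m<n⇒0<n∸m j<i) (≤-<-trans (m∸n≤m i j) i<)
                         (^≡^⇒^∸≡ε x (<⇒≤ j<i) (sym eq)))

  ord≡1⇒≡ε : ∀ x → ord x ≡ 1 → x ≡ ε
  ord≡1⇒≡ε x ord≡1 = trans (sym (^-1 x)) (subst (λ k → x ^ᴳ k ≡ ε) ord≡1 (^-ord x))

  infix 4 _∈⟨_⟩
  _∈⟨_⟩ : Fin n → Fin n → Set
  g ∈⟨ x ⟩ = ∃ λ a → g ≡ x ^ᴳ a

  ^-∈⟨⟩ : ∀ x a → x ^ᴳ a ∈⟨ x ⟩
  ^-∈⟨⟩ x a = a , refl

  ∈⟨⟩-refl : ∀ x → x ∈⟨ x ⟩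
  ∈⟨⟩-refl x = 1 , sym (^-1 x)

  ∈⟨⟩-trans : ∀ {g y x} → g ∈⟨ y ⟩ → y ∈⟨ x ⟩ → g ∈⟨ x ⟩
  ∈⟨⟩-trans {x = x} (b , refl) (a , refl) = a * b , sym (^-* x a b)

  ε-∈⟨⟩ : ∀ x → ε ∈⟨ x ⟩
  ε-∈⟨⟩ x = 0 , refl

  ∙-∈⟨⟩ : ∀ {g h x} → g ∈⟨ x ⟩ → h ∈⟨ x ⟩ → g ∙ h ∈⟨ x ⟩
  ∙-∈⟨⟩ {x = x} (a , refl) (b , refl) = a + b , sym (^-+ x a b)

  ⁻¹-∈⟨⟩ : ∀ x → x ⁻¹ ∈⟨ x ⟩
  ⁻¹-∈⟨⟩ x = ord x ∸ 1 , sym (inverseʳ-unique x _ (begin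
    x ∙ x ^ᴳ (ord x ∸ 1)     ≡⟨⟩
    x ^ᴳ suc (ord x ∸ 1)     ≡⟨ cong (x ^ᴳ_) (suc-pred (ord x)) ⟩
    x ^ᴳ ord x               ≡⟨ ^-ord x ⟩
    ε                        ∎))
    where open ≡-Reasoning

  ∈⟨ε⟩⇒≡ε : ∀ {g} → g ∈⟨ ε ⟩ → g ≡ ε
  ∈⟨ε⟩⇒≡ε (a , refl) = ε^ a

  _∈⟨_⟩? : ∀ g x → Dec (g ∈⟨ x ⟩)
  g ∈⟨ x ⟩? = map′ (λ (a , _ , eq) → a , eq)
                   (λ (a , eq) → a % ord x , m%n<n a (ord x) , trans eq (^-%ord x a))
                   (anyUpTo? (λ a → g ≟ x ^ᴳ a) (ord x))

  ^gcd-∈⟨⟩ : ∀ x a → x ^ᴳ gcd a (ord x) ∈⟨ x ^ᴳ a ⟩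
  ^gcd-∈⟨⟩ x a with Bézout.identity (gcd-GCD a (ord x))
  ... | Bézout.+- u v d+v*ord≡u*a = u , (begin
    x ^ᴳ d                        ≡⟨ identityʳ _ ⟨
    x ^ᴳ d ∙ ε                    ≡⟨ cong (x ^ᴳ d ∙_) (ord∣⇒^≡ε x (n∣m*n v)) ⟨
    x ^ᴳ d ∙ x ^ᴳ (v * ord x)     ≡⟨ ^-+ x d _ ⟨
    x ^ᴳ (d + v * ord x)          ≡⟨ cong (x ^ᴳ_) (trans d+v*ord≡u*a (*-comm u a)) ⟩
    x ^ᴳ (a * u)                  ≡⟨ ^-* x a u ⟩
    x ^ᴳ a ^ᴳ u                   ∎)
    where
    open ≡-Reasoning
    d : ℕ
    d = gcd a (ord x)
  ... | Bézout.-+ u v d+u*a≡v*ord =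
    ∈⟨⟩-trans (subst (_∈⟨ x ^ᴳ a ^ᴳ u ⟩) (sym x^d≡) (⁻¹-∈⟨⟩ _)) (^-∈⟨⟩ (x ^ᴳ a) u)
    where
    open ≡-Reasoning
    d : ℕ
    d = gcd a (ord x)
    x^d≡ : x ^ᴳ d ≡ (x ^ᴳ a ^ᴳ u) ⁻¹
    x^d≡ = inverseˡ-unique _ _ (begin
      x ^ᴳ d ∙ x ^ᴳ a ^ᴳ u      ≡⟨ cong (x ^ᴳ d ∙_) (^-* x a u) ⟨
      x ^ᴳ d ∙ x ^ᴳ (a * u)     ≡⟨ ^-+ x d _ ⟨
      x ^ᴳ (d + a * u)          ≡⟨ cong (λ k → x ^ᴳ (d + k)) (*-comm a u) ⟩
      x ^ᴳ (d + u * a)          ≡⟨ cong (x ^ᴳ_) d+u*a≡v*ord ⟩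
      x ^ᴳ (v * ord x)          ≡⟨ ord∣⇒^≡ε x (n∣m*n v) ⟩
      ε                         ∎)

module Lagrange (G : FiniteGroup) where
  open FiniteGroup G
  open IsGroup isGroup using (assoc; identityˡ)
  open Order G
  open import Algebra.Properties.Group group using (∙-cancelʳ; \\-leftDividesʳ)

  module _ (x : Fin n) where
    open import Data.List.Properties using (length-applyUpTo; length-tabulate)
    open import Data.List.Membership.Propositional using (_∈_)
    open import Data.List.Membership.Propositional.Properties
      using (∈-applyUpTo⁺; ∈-applyUpTo⁻; ∈-filter⁺; ∈-filter⁻; ∈-allFin)
    open import Data.List.Membership.DecPropositional (_≟_ {n}) using (_∈?_)
    open import Data.List.Membership.Propositional.Properties.WithK using (unique∧set⇒bag)
    open import Data.List.Relation.Unary.Any using (here)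
    open import Data.List.Relation.Unary.Unique.Propositional using (Unique)
    open import Data.List.Relation.Unary.Unique.Propositional.Properties
      using (applyUpTo⁺₁; filter⁺; allFin⁺)
    open import Data.List.Relation.Binary.BagAndSetEquality using (∼bag⇒↭)
    open import Data.List.Relation.Binary.Permutation.Propositional.Properties using (↭-length)
    open import Relation.Nullary using (¬?)

    coset : Fin n → List (Fin n)
    coset g = applyUpTo (λ i → x ^ᴳ i ∙ g) (ord x)

    coset-unique : ∀ g → Unique (coset g)
    coset-unique g = applyUpTo⁺₁ _ (ord x) λ i<j j<ord eq →
      <⇒≢ i<j (^-injective-below-ord x (<-trans i<j j<ord) j<ord (∙-cancelʳ g _ _ eq))

    ∈-coset : ∀ a g → x ^ᴳ a ∙ g ∈ coset g
    ∈-coset a g = subst (_∈ coset g) (cong (_∙ g) (sym (^-%ord x a)))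
                    (∈-applyUpTo⁺ (λ i → x ^ᴳ i ∙ g) (m%n<n a (ord x)))

    ∙-∈-coset⁻ : ∀ {g h} → x ∙ h ∈ coset g → h ∈ coset g
    ∙-∈-coset⁻ {g} {h} xh∈ with ∈-applyUpTo⁻ (λ i → x ^ᴳ i ∙ g) xh∈ | ⁻¹-∈⟨⟩ x
    ... | i , _ , xh≡ | b , x⁻¹≡ = subst (_∈ coset g) (sym h≡) (∈-coset (b + i) g)
      where
      open ≡-Reasoning
      h≡ : h ≡ x ^ᴳ (b + i) ∙ g
      h≡ = begin
        h                          ≡⟨ \\-leftDividesʳ x h ⟨
        (x ⁻¹) ∙ (x ∙ h)           ≡⟨ cong₂ _∙_ x⁻¹≡ xh≡ ⟩
        x ^ᴳ b ∙ (x ^ᴳ i ∙ g)      ≡⟨ assoc _ _ _ ⟨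
        (x ^ᴳ b ∙ x ^ᴳ i) ∙ g      ≡⟨ cong (_∙ g) (^-+ x b i) ⟨
        x ^ᴳ (b + i) ∙ g           ∎

    LeftClosed : List (Fin n) → Set
    LeftClosed A = ∀ {h} → h ∈ A → x ∙ h ∈ A

    coset-⊆ : ∀ {A g h} → LeftClosed A → g ∈ A → h ∈ coset g → h ∈ A
    coset-⊆ {A} {g} closed g∈A h∈ with ∈-applyUpTo⁻ (λ i → x ^ᴳ i ∙ g) h∈
    ... | i , _ , refl = ^∙-∈ i
      where
      ^∙-∈ : ∀ i → x ^ᴳ i ∙ g ∈ A
      ^∙-∈ zero    = subst (_∈ A) (sym (identityˡ g)) g∈A
      ^∙-∈ (suc i) = subst (_∈ A) (sym (assoc x (x ^ᴳ i) g)) (closed (^∙-∈ i))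

    module _ {A} (uniqueA : Unique A) (closedA : LeftClosed A) {g} (g∈A : g ∈ A) where
      outside : List (Fin n)
      outside = filter (λ h → ¬? (h ∈? coset g)) A

      length-split : length A ≡ ord x + length outside
      length-split = trans (length-filter-split (_∈? coset g) A) (cong (_+ length outside) inside≡)
        where
        inside≡ : length (filter (_∈? coset g) A) ≡ ord x
        inside≡ = trans
          (↭-length (∼bag⇒↭ (unique∧set⇒bag
            (filter⁺ (_∈? coset g) {xs = A} uniqueA) (coset-unique g)
            (mk⇔ (λ h∈ → proj₂ (∈-filter⁻ (_∈? coset g) {xs = A} h∈))
                 (λ h∈ → ∈-filter⁺ (_∈? coset g) {xs = A} (coset-⊆ closedA g∈A h∈) h∈)))))
          (length-applyUpTo _ (ord x))

      outside-unique : Unique outside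
      outside-unique = filter⁺ (λ h → ¬? (h ∈? coset g)) {xs = A} uniqueA

      outside-closed : LeftClosed outside
      outside-closed h∈ with ∈-filter⁻ (λ h → ¬? (h ∈? coset g)) {xs = A} h∈
      ... | h∈A , h∉ = ∈-filter⁺ (λ h → ¬? (h ∈? coset g)) {xs = A} (closedA h∈A) (h∉ ∘ ∙-∈-coset⁻)

    -- A list closed under left multiplication by x is a disjoint union of cosets ⟨x⟩g,
    -- each of length ord x; peel one off and recurse (k bounds the length).
    ord∣length : ∀ k {A} → length A ≤ k → Unique A → LeftClosed A → ord x ∣ length A
    ord∣length _       {[]}    _   _       _       = ord x ∣0
    ord∣length (suc k) {g ∷ A} len uniqueA closedA =
      subst (ord x ∣_) (sym split) (∣m∣n⇒∣m+n ∣-refl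
        (ord∣length k (s≤s⁻¹ (<-≤-trans rest<A len))
          (outside-unique uniqueA closedA g∈) (outside-closed uniqueA closedA g∈)))
      where
      g∈ : g ∈ g ∷ A
      g∈ = here refl
      rest : List (Fin n)
      rest = outside uniqueA closedA g∈
      split : length (g ∷ A) ≡ ord x + length rest
      split = length-split uniqueA closedA g∈
      rest<A : length rest < length (g ∷ A)
      rest<A = subst (length rest <_) (sym split) (m<n+m _ (>-nonZero⁻¹ (ord x)))

    ord∣n : ord x ∣ n
    ord∣n = subst (ord x ∣_) (length-tabulate id)
      (ord∣length n (≤-reflexive (length-tabulate id)) (allFin⁺ n) (λ {h} _ → ∈-allFin (x ∙ h)))

module PrimePowerOrder (G : FiniteGroup) {p} (p-prime : Prime p) where
  open FiniteGroup G
  open Order G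
  open PrimePowerDivisors p-prime using (∣p^[1+m]⇒≡∨∣p^m)

  private instance
    p-nonZero : NonZero p
    p-nonZero = prime⇒nonZero p-prime
    p-nonTrivial : NonTrivial p
    p-nonTrivial = prime⇒nonTrivial p-prime

  ω : Fin n → Fin n
  ω x = x ^ᴳ (ord x / p)

  ω-∈⟨⟩ : ∀ x → ω x ∈⟨ x ⟩
  ω-∈⟨⟩ x = ^-∈⟨⟩ x (ord x / p)

  module _ {x} (p∣ord : p ∣ ord x) where

    ω-^p : ω x ^ᴳ p ≡ ε
    ω-^p = trans (sym (^-* x (ord x / p) p)) (trans (cong (x ^ᴳ_) (m/n*n≡m p∣ord)) (^-ord x))

    ω-≢ε : ω x ≢ ε
    ω-≢ε = ^≢ε-below-ord x (m≥n⇒m/n>0 (∣⇒≤ p∣ord)) (m/n<m (ord x) p (nonTrivial⇒n>1 p))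

    ord/p∣ : ∀ {c} → x ^ᴳ c ^ᴳ p ≡ ε → ord x / p ∣ c
    ord/p∣ {c} x^c^p≡ε = *-cancelʳ-∣ p (subst (_∣ c * p) (sym (m/n*n≡m p∣ord))
                           (^≡ε⇒ord∣ x (trans (^-* x c p) x^c^p≡ε)))

    ∈⟨ω⟩ : ∀ {g} → g ∈⟨ x ⟩ → g ^ᴳ p ≡ ε → g ∈⟨ ω x ⟩
    ∈⟨ω⟩ (c , refl) x^c^p≡ε with ord/p∣ {c} x^c^p≡ε
    ... | divides q refl = q , trans (cong (x ^ᴳ_) (*-comm q (ord x / p))) (^-* x (ord x / p) q)

  ω-∈⟨⟩-nontrivial : ∀ {x y} → (∃ λ m → ord x ≡ p ^ suc m) → y ∈⟨ x ⟩ → y ≢ ε → ω x ∈⟨ y ⟩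
  ω-∈⟨⟩-nontrivial {x} (m , ord≡) (a , refl) x^a≢ε
    with ∣p^[1+m]⇒≡∨∣p^m m (subst (gcd a (ord x) ∣_) ord≡ (gcd[m,n]∣n a (ord x)))
  ... | inj₁ d≡ =
    ⊥-elim (x^a≢ε (ord∣⇒^≡ε x (subst (_∣ a) (trans d≡ (sym ord≡)) (gcd[m,n]∣m a (ord x)))))
  ... | inj₂ (divides q p^m≡) = ∈⟨⟩-trans (q , ω≡) (^gcd-∈⟨⟩ x a)
    where
    ω≡ : ω x ≡ x ^ᴳ gcd a (ord x) ^ᴳ q
    ω≡ = begin
      x ^ᴳ (ord x / p)               ≡⟨ cong (λ k → x ^ᴳ (k / p)) ord≡ ⟩
      x ^ᴳ (p ^ suc m / p)           ≡⟨ cong (λ k → x ^ᴳ (k / p)) (*-comm p (p ^ m)) ⟩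
      x ^ᴳ (p ^ m * p / p)           ≡⟨ cong (x ^ᴳ_) (m*n/n≡m (p ^ m) p) ⟩
      x ^ᴳ (p ^ m)                   ≡⟨ cong (x ^ᴳ_) (trans p^m≡ (*-comm q _)) ⟩
      x ^ᴳ (gcd a (ord x) * q)       ≡⟨ ^-* x (gcd a (ord x)) q ⟩
      x ^ᴳ gcd a (ord x) ^ᴳ q        ∎
      where open ≡-Reasoning

module CyclicSubgroup (G : FiniteGroup) where
  open FiniteGroup G
  open Order G
  open import Data.Fin.Subset using (Subset; _∈_; _⊆_)
  open import Data.Vec.Base using (tabulate)
  open import Data.Vec.Properties using (lookup∘tabulate; []=⇒lookup; lookup⇒[]=)
  open import Data.Bool.Properties using (T-≡)
  open import Relation.Nullary.Decidable using (⌊_⌋; toWitness; fromWitness)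

  ⟨_⟩ : Fin n → Subset n
  ⟨ x ⟩ = tabulate (λ g → ⌊ g ∈⟨ x ⟩? ⌋)

  ∈⟨⟩⇒∈ : ∀ {g x} → g ∈⟨ x ⟩ → g ∈ ⟨ x ⟩
  ∈⟨⟩⇒∈ {g} g∈ =
    lookup⇒[]= g _ (trans (lookup∘tabulate _ g) (Equivalence.to T-≡ (fromWitness g∈)))

  ∈⇒∈⟨⟩ : ∀ {g x} → g ∈ ⟨ x ⟩ → g ∈⟨ x ⟩
  ∈⇒∈⟨⟩ {g} g∈ =
    toWitness (Equivalence.from T-≡ (trans (sym (lookup∘tabulate _ g)) ([]=⇒lookup g∈)))

  ⟨⟩-isSubgroup : ∀ x → IsSubgroup G ⟨ x ⟩
  ⟨⟩-isSubgroup x =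
      ∈⟨⟩⇒∈ (ε-∈⟨⟩ x)
    , (λ g∈ h∈ → ∈⟨⟩⇒∈ (∙-∈⟨⟩ (∈⇒∈⟨⟩ g∈) (∈⇒∈⟨⟩ h∈)))
    , (λ g∈ → ∈⟨⟩⇒∈ (∈⟨⟩-trans (⁻¹-∈⟨⟩ _) (∈⇒∈⟨⟩ g∈)))

  ⟨⟩-least : ∀ {T x} → IsSubgroup G T → x ∈ T → ⟨ x ⟩ ⊆ T
  ⟨⟩-least {T} {x} (ε∈T , ∙∈T , _) x∈T g∈ with ∈⇒∈⟨⟩ g∈
  ... | a , refl = ^∈T a
    where
    ^∈T : ∀ a → x ^ᴳ a ∈ T
    ^∈T zero    = ε∈T
    ^∈T (suc a) = ∙∈T x∈T (^∈T a)

  ⟨⟩-mono : ∀ {g x} → g ∈⟨ x ⟩ → ⟨ g ⟩ ⊆ ⟨ x ⟩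
  ⟨⟩-mono {x = x} g∈ = ⟨⟩-least (⟨⟩-isSubgroup x) (∈⟨⟩⇒∈ g∈)

  ⟨⟩-nontrivial : ∀ {x} → x ≢ ε → Nontrivial G ⟨ x ⟩
  ⟨⟩-nontrivial {x} x≢ε = x , ∈⟨⟩⇒∈ (∈⟨⟩-refl x) , x≢ε

module EnhancedPowerGraph (G : FiniteGroup) where
  open FiniteGroup G
  open Order G

  DPath-trans : ∀ {x y z} → DPath G x y → DPath G y z → DPath G x z
  DPath-trans here                   q = q
  DPath-trans (step x≢ε y≢ε x~y p) q = step x≢ε y≢ε x~y (DPath-trans p q)

  ∈⟨⟩⇒DPath : ∀ {x y} → x ≢ ε → y ≢ ε → y ∈⟨ x ⟩ → DPath G x y × DPath G y x
  ∈⟨⟩⇒DPath {x} {y} x≢ε y≢ε (a , y≡) with x ≟ y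
  ... | yes refl = here , here
  ... | no x≢y   = step x≢ε y≢ε (x≢y , x , 1 , a , sym (^-1 x) , y≡) here
                 , step y≢ε x≢ε (x≢y ∘ sym , x , a , 1 , y≡ , sym (^-1 x)) here

module PGroup (G : FiniteGroup) {p} (p-prime : Prime p) (pgroup : IsPGroup G p) where
  open FiniteGroup G
  open Order G
  open PrimePowerOrder G p-prime
  open Lagrange G using (ord∣n)
  open PrimePowerDivisors p-prime using (∣p^⇒≡p^)
  open CyclicSubgroup G
  open EnhancedPowerGraph G
  open import Data.Fin.Subset using (Subset; _∈_; _⊆_)
  open import Data.Fin.Subset.Properties using (⊆-antisym)

  ord≡p^[1+m] : ∀ {x} → x ≢ ε → ∃ λ m → ord x ≡ p ^ suc m
  ord≡p^[1+m] {x} x≢ε with ∣p^⇒≡p^ (proj₁ pgroup) (subst (ord x ∣_) (proj₂ pgroup) (ord∣n x))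
  ... | zero  , ord≡1 = ⊥-elim (x≢ε (ord≡1⇒≡ε x ord≡1))
  ... | suc m , ord≡  = m , ord≡

  p∣ord : ∀ {x} → x ≢ ε → p ∣ ord x
  p∣ord x≢ε with ord≡p^[1+m] x≢ε
  ... | m , ord≡ = divides (p ^ m) (trans ord≡ (*-comm p (p ^ m)))

  Ω : Fin n → Subset n
  Ω x = ⟨ ω x ⟩

  ∈⟨⟩⇒Ω≡ : ∀ {x y} → y ∈⟨ x ⟩ → y ≢ ε → Ω y ≡ Ω x
  ∈⟨⟩⇒Ω≡ {x} {y} y∈⟨x⟩ y≢ε = ⊆-antisym (⟨⟩-mono ωy∈⟨ωx⟩) (⟨⟩-mono ωx∈⟨ωy⟩)
    where
    x≢ε : x ≢ ε
    x≢ε refl = y≢ε (∈⟨ε⟩⇒≡ε y∈⟨x⟩)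
    ωy∈⟨ωx⟩ : ω y ∈⟨ ω x ⟩
    ωy∈⟨ωx⟩ = ∈⟨ω⟩ (p∣ord x≢ε) (∈⟨⟩-trans (ω-∈⟨⟩ y) y∈⟨x⟩) (ω-^p (p∣ord y≢ε))
    ωx∈⟨ωy⟩ : ω x ∈⟨ ω y ⟩
    ωx∈⟨ωy⟩ = ∈⟨ω⟩ (p∣ord y≢ε) (ω-∈⟨⟩-nontrivial (ord≡p^[1+m] x≢ε) y∈⟨x⟩ y≢ε) (ω-^p (p∣ord x≢ε))

  Ω-isSubgroup : ∀ x → IsSubgroup G (Ω x)
  Ω-isSubgroup x = ⟨⟩-isSubgroup (ω x)

  Ω-nontrivial : ∀ {x} → x ≢ ε → Nontrivial G (Ω x)
  Ω-nontrivial x≢ε = ⟨⟩-nontrivial (ω-≢ε (p∣ord x≢ε))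

  Ω-least : ∀ {T x} → IsSubgroup G T → x ∈ T → Ω x ⊆ T
  Ω-least T-sub x∈T = ⟨⟩-least T-sub (⟨⟩-least T-sub x∈T (∈⟨⟩⇒∈ (ω-∈⟨⟩ _)))

  Ω-isMinimal : ∀ {x} → x ≢ ε → IsMinimalSubgroup G (Ω x)
  Ω-isMinimal {x} x≢ε = Ω-isSubgroup x , Ω-nontrivial x≢ε , minimal
    where
    minimal : ∀ T → IsSubgroup G T → Nontrivial G T → T ⊆ Ω x → T ≡ Ω x
    minimal T T-sub (t , t∈T , t≢ε) T⊆Ωx = ⊆-antisym T⊆Ωx
      (subst (_⊆ T) (∈⟨⟩⇒Ω≡ (∈⟨⟩-trans (∈⇒∈⟨⟩ (T⊆Ωx t∈T)) (ω-∈⟨⟩ x)) t≢ε) (Ω-least T-sub t∈T))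

  minimal≡Ω : ∀ {S s} → IsMinimalSubgroup G S → s ∈ S → s ≢ ε → S ≡ Ω s
  minimal≡Ω {S} {s} (S-sub , _ , minimal) s∈S s≢ε =
    sym (minimal (Ω s) (Ω-isSubgroup s) (Ω-nontrivial s≢ε) (Ω-least S-sub s∈S))

  DPath⇒Ω≡ : ∀ {x y} → DPath G x y → Ω x ≡ Ω y
  DPath⇒Ω≡ here = refl
  DPath⇒Ω≡ (step x≢ε y≢ε (_ , z , a , b , refl , refl) path) =
    trans (∈⟨⟩⇒Ω≡ (^-∈⟨⟩ z a) x≢ε) (trans (sym (∈⟨⟩⇒Ω≡ (^-∈⟨⟩ z b) y≢ε)) (DPath⇒Ω≡ path))

  connected⇒uniqueMinimal : DeletedEnhancedConnected G → HasUniqueMinimalSubgroup G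
  connected⇒uniqueMinimal ((x , x≢ε) , connected) = Ω x , Ω-isMinimal x≢ε , unique
    where
    unique : ∀ T → IsMinimalSubgroup G T → T ≡ Ω x
    unique T T-min@(_ , (t , t∈T , t≢ε) , _) =
      trans (minimal≡Ω T-min t∈T t≢ε) (DPath⇒Ω≡ (connected t x t≢ε x≢ε))

  uniqueMinimal⇒connected : HasUniqueMinimalSubgroup G → DeletedEnhancedConnected G
  uniqueMinimal⇒connected (S , (_ , (s , s∈S , s≢ε) , _) , unique) =
    (s , s≢ε) , λ x y x≢ε y≢ε →
      DPath-trans (proj₁ (path-to-s x≢ε)) (proj₂ (path-to-s y≢ε))
    where
    s∈⟨⟩ : ∀ {x} → x ≢ ε → s ∈⟨ x ⟩
    s∈⟨⟩ {x} x≢ε =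
      ∈⟨⟩-trans (∈⇒∈⟨⟩ (subst (s ∈_) (sym (unique (Ω x) (Ω-isMinimal x≢ε))) s∈S)) (ω-∈⟨⟩ x)
    path-to-s : ∀ {x} → x ≢ ε → DPath G x s × DPath G s x
    path-to-s x≢ε = ∈⟨⟩⇒DPath x≢ε s≢ε (s∈⟨⟩ x≢ε)

theorem5p1 : (G : FiniteGroup) (p : ℕ) → Prime p → IsPGroup G p →
    (DeletedEnhancedConnected G ⇔ HasUniqueMinimalSubgroup G)
theorem5p1 G p p-prime pgroup = mk⇔ connected⇒uniqueMinimal uniqueMinimal⇒connected
  where open PGroup G p-prime pgroup
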